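{- Let $n\ge2$ and $k$ be integers with $1\le k\le n-1$, and let $G$ be a simple connected graph on $n$ vertices with vertex connectivity $\kappa(G)\le k$. Then $\prod_1(G)\ge (n-1)^2$, with equality if and only if $G\cong S_n$, and $\prod_2(G)\ge 4^{n-2}$, with equality if and only if $G\cong P_n$.
   Context: $d(v)$ is the degree of $v$. $\prod_1(G)=\prod_{u\in V(G)} d(u)^2$ and $\prod_2(G)=\prod_{uv\in E(G)} d(u)d(v)$. $\kappa(G)$ is the vertex connectivity (largest $k$ such that $G$ is $K_{k+1}$ or has at least $k+2$ vertices and no vertex cut of size $k-1$). $S_n$ is the star and $P_n$ the path on $n$ vertices. -}

module Defs where

open import Data.Nat using (ℕ; zero; suc; _+_; _*_; _<_; _≤_; _^_; _≡ᵇ_; _<ᵇ_)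
open import Data.Bool using (Bool; true; false; if_then_else_; _xor_; _∨_; _∧_)
open import Data.Fin using (Fin; toℕ)
open import Data.Fin.Subset using (Subset; _∉_; ∣_∣; ⊥)
open import Data.List using (List; map; allFin)
open import Data.Nat.ListAction using (sum; product)
open import Data.Product using (_×_; Σ)
open import Data.Sum using (_⊎_)
open import Function.Bundles using (_↔_; Inverse)
open import Relation.Binary.PropositionalEquality using (_≡_; _≢_)

record SimpleGraph (n : ℕ) : Set where
  field
    adj    : Fin n → Fin n → Bool
    sym    : ∀ i j → adj i j ≡ adj j i
    irrefl : ∀ i → adj i i ≡ false
open SimpleGraph public

deg : ∀ {n} → SimpleGraph n → Fin n → ℕ
deg {n} G v = sum (map (λ u → if adj G v u then 1 else 0) (allFin n))

Π₁ : ∀ {n} → SimpleGraph n → ℕ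
Π₁ {n} G = product (map (λ u → deg G u ^ 2) (allFin n))

-- Π₂(G) = ∏_{uv ∈ E(G)} d(u) d(v); each edge {u,v} counted once (u < v)
Π₂ : ∀ {n} → SimpleGraph n → ℕ
Π₂ {n} G = product (map (λ u → product (map (λ v →
             if (toℕ u <ᵇ toℕ v) ∧ adj G u v
             then deg G u * deg G v else 1) (allFin n))) (allFin n))

data Walk {n} (G : SimpleGraph n) (S : Subset n) : Fin n → Fin n → Set where
  nil  : ∀ {u} → u ∉ S → Walk G S u u
  cons : ∀ {u v w} → u ∉ S → adj G u v ≡ true → Walk G S v w → Walk G S u w

ConnectedAvoiding : ∀ {n} → SimpleGraph n → Subset n → Set
ConnectedAvoiding G S = ∀ u v → u ∉ S → v ∉ S → Walk G S u v

Connected : ∀ {n} → SimpleGraph n → Set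
Connected G = ConnectedAvoiding G ⊥

IsComplete : ∀ {n} → SimpleGraph n → ℕ → Set
IsComplete {n} G m = (n ≡ m) × (∀ i j → i ≢ j → adj G i j ≡ true)

KConnected : ∀ {n} → SimpleGraph n → ℕ → Set
KConnected {n} G k =
  IsComplete G (suc k) ⊎
  ((suc (suc k) ≤ n) × (∀ (S : Subset n) → ∣ S ∣ < k → ConnectedAvoiding G S))

-- κ(G) ≤ k, where κ(G) is the largest j such that G is j-connected.
κ≤ : ∀ {n} → SimpleGraph n → ℕ → Set
κ≤ G k = ∀ j → KConnected G j → j ≤ k

_≅_ : ∀ {n} → SimpleGraph n → (Fin n → Fin n → Bool) → Set
_≅_ {n} G H = Σ (Fin n ↔ Fin n) λ σ →
  ∀ i j → H (Inverse.to σ i) (Inverse.to σ j) ≡ adj G i j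

-- Star S_n: vertex 0 adjacent to every other vertex, no other edges
starAdj : ∀ {n} → Fin n → Fin n → Bool
starAdj i j = (toℕ i ≡ᵇ 0) xor (toℕ j ≡ᵇ 0)

pathAdj : ∀ {n} → Fin n → Fin n → Bool
pathAdj i j = (suc (toℕ i) ≡ᵇ toℕ j) ∨ (suc (toℕ j) ≡ᵇ toℕ i)

-- Connectedness gives every degree the form d(v) = 1 + e(v), and growing a vertex
-- set along edges shows that G has at least n - 1 edges, i.e. ∑ e ≥ n - 2.
-- * Π₁ = (∏ d)², and expanding ∏ (1 + e) gives ∏ d ≥ 1 + ∑ e + e(i)e(j) for i ≠ j.  Hence
--   Π₁ ≥ (n-1)², and equality forces ∑ e = n - 2 with at most one vertex of positive
--   excess; that vertex is adjacent to all others and G is the star.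
-- * Π₂ = ∏ d(u)^d(u), since each edge uv contributes one factor d(u) and one factor d(v).
--   As d^d ≥ 4^(d-1), with equality iff d ≤ 2, Π₂ ≥ 4^(∑ e) ≥ 4^(n-2); equality forces
--   maximum degree 2 and a vertex of degree 1, and the walk from it that never steps back
--   visits every vertex, numbering G as a path.
-- * Conversely the degree sequences of Sₙ and Pₙ attain both bounds.
module Submission where

import Algebra.Properties.CommutativeMonoid.Sum as CommutativeMonoidSum
open import Data.Bool as Bool using (Bool; true; false; if_then_else_; _∧_; _∨_; _xor_)
open import Data.Bool.Properties using (∨-zeroʳ; ¬-not; T-≡; ⇔→≡)
open import Data.Fin using (Fin; zero; suc; toℕ; fromℕ; fromℕ<; punchOut)
open import Data.Fin.Permutation using (transpose; _⟨$⟩ʳ_)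
open import Data.Fin.Properties
  using (toℕ-injective; toℕ-fromℕ; toℕ-fromℕ<; toℕ≤pred[n]; any?; injective⇒≤; punchOut-injective)
  renaming (_≟_ to _≟ᶠ_; suc-injective to suc-injectiveᶠ)
open import Data.Fin.Subset.Properties using (∉⊥)
open import Data.List using (map; allFin; tabulate)
open import Data.List.Properties using (map-tabulate)
open import Data.Nat using (ℕ; zero; suc; _+_; _*_; _∸_; _^_; _≤_; _<_; z≤n; s≤s; s≤s⁻¹; _≡ᵇ_; _<ᵇ_; >-nonZero)
open import Data.Nat.ListAction using (sum; product)
open import Data.Nat.Properties
open import Data.Nat.Solver using (module +-*-Solver)
open import Data.Product using (_×_; _,_; ∃; proj₁; proj₂)
open import Data.Sum as Sum using (_⊎_; inj₁; inj₂)
open import Defs renaming (sym to adj-sym)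
open import Function using (_∘_; id)
open import Function.Bundles using (Inverse; Equivalence; _⇔_; mk⇔; mk↔ₛ′)
open import Relation.Binary using (tri<; tri≈; tri>)
open import Relation.Binary.PropositionalEquality
open import Relation.Nullary using (¬_; yes; no; does; contradiction; ¬?; _×-dec_)
open import Relation.Nullary.Decidable using (decidable-stable)
open import Relation.Unary using (Pred; Decidable)
open +-*-Solver using (solve; _:+_; _:*_; con; _:=_)

module Additive       = CommutativeMonoidSum +-0-commutativeMonoid
module Multiplicative = CommutativeMonoidSum *-1-commutativeMonoid

∑ : ∀ {n} → (Fin n → ℕ) → ℕ
∑ = Additive.sum

∏ : ∀ {n} → (Fin n → ℕ) → ℕ
∏ = Multiplicative.sum

∑-cong : ∀ {n} {f g : Fin n → ℕ} → (∀ i → f i ≡ g i) → ∑ f ≡ ∑ g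
∑-cong = Additive.sum-cong-≗

∏-cong : ∀ {n} {f g : Fin n → ℕ} → (∀ i → f i ≡ g i) → ∏ f ≡ ∏ g
∏-cong = Multiplicative.sum-cong-≗

ind : Bool → ℕ
ind b = if b then 1 else 0

δ : ∀ {n} → Fin n → Fin n → ℕ
δ y i = ind (does (y ≟ᶠ i))

sum-allFin : ∀ {n} (f : Fin n → ℕ) → sum (map f (allFin n)) ≡ ∑ f
sum-allFin f = trans (cong sum (map-tabulate id f)) (sum-tabulate f)
  where
  sum-tabulate : ∀ {n} (f : Fin n → ℕ) → sum (tabulate f) ≡ ∑ f
  sum-tabulate {zero}  f = refl
  sum-tabulate {suc n} f = cong (f zero +_) (sum-tabulate (f ∘ suc))

product-allFin : ∀ {n} (f : Fin n → ℕ) → product (map f (allFin n)) ≡ ∏ f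
product-allFin f = trans (cong product (map-tabulate id f)) (product-tabulate f)
  where
  product-tabulate : ∀ {n} (f : Fin n → ℕ) → product (tabulate f) ≡ ∏ f
  product-tabulate {zero}  f = refl
  product-tabulate {suc n} f = cong (f zero *_) (product-tabulate (f ∘ suc))

∑-const : ∀ {n} c → ∑ {n} (λ _ → c) ≡ n * c
∑-const {zero}  c = refl
∑-const {suc n} c = cong (c +_) (∑-const {n} c)

∑-zero : ∀ {n} → ∑ {n} (λ _ → 0) ≡ 0
∑-zero {n} = trans (∑-const {n} 0) (*-zeroʳ n)

∑-one : ∀ {n} → ∑ {n} (λ _ → 1) ≡ n
∑-one {n} = trans (∑-const {n} 1) (*-identityʳ n)

∑-suc : ∀ {n} (e : Fin n → ℕ) → ∑ (suc ∘ e) ≡ n + ∑ e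
∑-suc {n} e = trans (Additive.∑-distrib-+ (λ _ → 1) e) (cong (_+ ∑ e) (∑-one {n}))

∑-single : ∀ {n} (f : Fin n → ℕ) c → (∀ i → i ≢ c → f i ≡ 0) → ∑ f ≡ f c
∑-single {suc n} f zero    rest =
  trans (cong (f zero +_) (trans (∑-cong (λ i → rest (suc i) λ ())) (∑-zero {n}))) (+-identityʳ _)
∑-single {suc n} f (suc c) rest =
  trans (cong (_+ ∑ (f ∘ suc)) (rest zero λ ())) (∑-single (f ∘ suc) c (λ i i≢c → rest (suc i) (i≢c ∘ suc-injectiveᶠ)))

∏-^ : ∀ {n} (f : Fin n → ℕ) k → ∏ (λ i → f i ^ k) ≡ ∏ f ^ k
∏-^ {n} f zero    = Multiplicative.sum-replicate-zero n
∏-^     f (suc k) = trans (Multiplicative.∑-distrib-+ f (λ i → f i ^ k)) (cong (∏ f *_) (∏-^ f k))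

∑-mono : ∀ {n} {f g : Fin n → ℕ} → (∀ i → f i ≤ g i) → ∑ f ≤ ∑ g
∑-mono {zero}  f≤g = z≤n
∑-mono {suc n} f≤g = +-mono-≤ (f≤g zero) (∑-mono (f≤g ∘ suc))

∏-mono : ∀ {n} {f g : Fin n → ℕ} → (∀ i → f i ≤ g i) → ∏ f ≤ ∏ g
∏-mono {zero}  f≤g = ≤-refl
∏-mono {suc n} f≤g = *-mono-≤ (f≤g zero) (∏-mono (f≤g ∘ suc))

term≤∑ : ∀ {n} (f : Fin n → ℕ) x → f x ≤ ∑ f
term≤∑ f zero    = m≤m+n _ _
term≤∑ f (suc x) = ≤-trans (term≤∑ (f ∘ suc) x) (m≤n+m _ _)

∑-δ : ∀ {n} (y : Fin n) → ∑ (δ y) ≡ 1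
∑-δ {suc n} zero    = cong suc (∑-zero {n})
∑-δ {suc n} (suc y) = trans (∑-cong shift) (∑-δ y)
  where
  shift : ∀ i → δ (suc y) (suc i) ≡ δ y i
  shift i with y ≟ᶠ i
  ... | yes refl = refl
  ... | no  _    = refl

∑-gain : ∀ {n} {f g : Fin n → ℕ} → (∀ i → f i ≤ g i) →
         ∀ x → f x < g x → suc (∑ f) ≤ ∑ g
∑-gain f≤g zero    fx<gx = +-mono-≤ fx<gx (∑-mono (f≤g ∘ suc))
∑-gain {g = g} f≤g (suc x) fx<gx =
  subst (_≤ ∑ g) (+-suc _ _) (+-mono-≤ (f≤g zero) (∑-gain (f≤g ∘ suc) x fx<gx))

∑-gain₂ : ∀ {n} {f g : Fin n → ℕ} → (∀ i → f i ≤ g i) →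
          ∀ {x y} → x ≢ y → f x < g x → f y < g y → 2 + ∑ f ≤ ∑ g
∑-gain₂ f≤g {zero}  {zero}  x≢y _ _ = contradiction refl x≢y
∑-gain₂ {g = g} f≤g {zero}  {suc y} _ fx<gx fy<gy =
  subst (_≤ ∑ g) (cong suc (+-suc _ _)) (+-mono-≤ fx<gx (∑-gain (f≤g ∘ suc) y fy<gy))
∑-gain₂ {g = g} f≤g {suc x} {zero}  _ fx<gx fy<gy =
  subst (_≤ ∑ g) (cong suc (+-suc _ _)) (+-mono-≤ fy<gy (∑-gain (f≤g ∘ suc) x fx<gx))
∑-gain₂ {g = g} f≤g {suc x} {suc y} x≢y fx<gx fy<gy =
  subst (_≤ ∑ g) (trans (+-suc _ _) (cong suc (+-suc _ _)))
    (+-mono-≤ (f≤g zero) (∑-gain₂ (f≤g ∘ suc) (x≢y ∘ cong suc) fx<gx fy<gy))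

∑<⇒∃< : ∀ {n} (f g : Fin n → ℕ) → ∑ f < ∑ g → ∃ λ i → f i < g i
∑<⇒∃< {zero}  f g ()
∑<⇒∃< {suc n} f g ∑f<∑g with f zero <? g zero
... | yes f0<g0 = zero , f0<g0
... | no  f0≮g0 =
  let i , fi<gi = ∑<⇒∃< (f ∘ suc) (g ∘ suc)
                    (+-cancelˡ-< (g zero) _ _ (≤-<-trans (+-monoˡ-≤ _ (≮⇒≥ f0≮g0)) ∑f<∑g))
  in suc i , fi<gi

∏-positive : ∀ {n} {f : Fin n → ℕ} → (∀ i → 1 ≤ f i) → 1 ≤ ∏ f
∏-positive {zero}  pos = ≤-refl
∏-positive {suc n} pos = *-mono-≤ (pos zero) (∏-positive (pos ∘ suc))

∏-pow : ∀ {n} x (e : Fin n → ℕ) → ∏ (λ i → x ^ e i) ≡ x ^ ∑ e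
∏-pow {zero}  x e = refl
∏-pow {suc n} x e =
  trans (cong (x ^ e zero *_) (∏-pow x (e ∘ suc))) (sym (^-distribˡ-+-* x (e zero) _))

∏-mono-< : ∀ {n} {f g : Fin n → ℕ} → (∀ i → 1 ≤ f i) → (∀ i → f i ≤ g i) →
           ∀ x → f x < g x → ∏ f < ∏ g
∏-mono-< {f = f} {g} pos f≤g zero fx<gx = begin-strict
  f zero * ∏ (f ∘ suc)  <⟨ *-monoˡ-< _ {{>-nonZero (∏-positive (pos ∘ suc))}} fx<gx ⟩
  g zero * ∏ (f ∘ suc)  ≤⟨ *-monoʳ-≤ (g zero) (∏-mono (f≤g ∘ suc)) ⟩
  g zero * ∏ (g ∘ suc)  ∎
  where open ≤-Reasoning
∏-mono-< {f = f} {g} pos f≤g (suc x) fx<gx = begin-strict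
  f zero * ∏ (f ∘ suc)  <⟨ *-monoʳ-< (f zero) {{>-nonZero (pos zero)}} (∏-mono-< (pos ∘ suc) (f≤g ∘ suc) x fx<gx) ⟩
  f zero * ∏ (g ∘ suc)  ≤⟨ *-monoˡ-≤ (∏ (g ∘ suc)) (f≤g zero) ⟩
  g zero * ∏ (g ∘ suc)  ∎
  where open ≤-Reasoning

-- Expanding ∏ (1 + eᵢ): the constant and linear terms give 1 + ∑ eᵢ ...
1+∑≤∏suc : ∀ {n} (e : Fin n → ℕ) → suc (∑ e) ≤ ∏ (suc ∘ e)
1+∑≤∏suc {zero}  e = ≤-refl
1+∑≤∏suc {suc n} e = begin
  suc (e zero + ∑ (e ∘ suc))   ≡⟨ cong suc (+-comm (e zero) _) ⟩
  suc (∑ (e ∘ suc)) + e zero   ≤⟨ +-mono-≤ rest (m≤m*n (e zero) _ {{>-nonZero (≤-trans (s≤s z≤n) rest)}}) ⟩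
  ∏ (suc ∘ e ∘ suc) + e zero * ∏ (suc ∘ e ∘ suc) ∎
  where
  open ≤-Reasoning
  rest : suc (∑ (e ∘ suc)) ≤ ∏ (suc ∘ e ∘ suc)
  rest = 1+∑≤∏suc (e ∘ suc)

-- ... and any two distinct indices contribute in addition their quadratic term.
cross-term≤∏suc : ∀ {n} (e : Fin n → ℕ) {i j} → i ≢ j →
                  suc (∑ e) + e i * e j ≤ ∏ (suc ∘ e)
cross-term≤∏suc e {zero}  {zero}  i≢j = contradiction refl i≢j
cross-term≤∏suc e {zero}  {suc j} _   = head-term e j
  where
  head-term : ∀ {n} (e : Fin (suc n) → ℕ) j → suc (∑ e) + e zero * e (suc j) ≤ ∏ (suc ∘ e)
  head-term e j = begin
    suc (a + s) + a * b        ≡⟨ solve 3 (λ a s t → con 1 :+ (a :+ s) :+ t := (con 1 :+ s) :+ (a :+ t)) refl a s (a * b) ⟩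
    suc s + (a + a * b)        ≡⟨ cong (suc s +_) (sym (*-suc a b)) ⟩
    suc s + a * suc b          ≤⟨ +-mono-≤ rest (*-monoʳ-≤ a (≤-trans (s≤s (term≤∑ (e ∘ suc) j)) rest)) ⟩
    ∏ (suc ∘ e ∘ suc) + a * ∏ (suc ∘ e ∘ suc) ∎
    where
    open ≤-Reasoning
    a = e zero
    b = e (suc j)
    s = ∑ (e ∘ suc)
    rest = 1+∑≤∏suc (e ∘ suc)
cross-term≤∏suc e {suc i} {zero}  i≢j =
  subst (λ t → suc (∑ e) + t ≤ ∏ (suc ∘ e)) (*-comm (e zero) (e (suc i)))
    (cross-term≤∏suc e {zero} {suc i} (i≢j ∘ sym))
cross-term≤∏suc e {suc i} {suc j} i≢j = begin
  suc (a + s) + c            ≡⟨ solve 3 (λ a s t → con 1 :+ (a :+ s) :+ t := (con 1 :+ s :+ t) :+ a) refl a s c ⟩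
  suc s + c + a              ≤⟨ +-mono-≤ rest (m≤m*n a _ {{>-nonZero (≤-trans (s≤s z≤n) rest)}}) ⟩
  ∏ (suc ∘ e ∘ suc) + a * ∏ (suc ∘ e ∘ suc) ∎
  where
  open ≤-Reasoning
  a = e zero
  s = ∑ (e ∘ suc)
  c = e (suc i) * e (suc j)
  rest = cross-term≤∏suc (e ∘ suc) (i≢j ∘ cong suc)

^-cancelˡ-≤ : ∀ k {x y} → x ^ suc k ≤ y ^ suc k → x ≤ y
^-cancelˡ-≤ k le = ≮⇒≥ (λ y<x → <⇒≱ (^-monoˡ-< (suc k) y<x) le)

4^-cancel-≤ : ∀ {a b} → 4 ^ a ≤ 4 ^ b → a ≤ b
4^-cancel-≤ le = ≮⇒≥ (λ b<a → <⇒≱ (^-monoʳ-< 4 (s≤s (s≤s z≤n)) b<a) le)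

suc-∸1 : ∀ {x} → 1 ≤ x → suc (x ∸ 1) ≡ x
suc-∸1 (s≤s _) = refl

4^pred<self^self : ∀ d → 3 ≤ d → 4 ^ (d ∸ 1) < d ^ d
4^pred<self^self 1 (s≤s ())
4^pred<self^self 2 (s≤s (s≤s ()))
4^pred<self^self (suc (suc (suc k))) _ = go k
  where
  go : ∀ k → 4 ^ (2 + k) < (3 + k) ^ (3 + k)
  go zero    = m≤m+n 17 10
  go (suc k) = begin-strict
    4 * 4 ^ (2 + k)              <⟨ *-monoʳ-< 4 (go k) ⟩
    4 * (3 + k) ^ (3 + k)        ≤⟨ *-monoˡ-≤ ((3 + k) ^ (3 + k)) (m≤m+n 4 k) ⟩
    (4 + k) * (3 + k) ^ (3 + k)  ≤⟨ *-monoʳ-≤ (4 + k) (^-monoˡ-≤ (3 + k) (n≤1+n (3 + k))) ⟩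
    (4 + k) * (4 + k) ^ (3 + k)  ∎
    where open ≤-Reasoning

4^pred≤self^self : ∀ d → 4 ^ (d ∸ 1) ≤ d ^ d
4^pred≤self^self 0 = ≤-refl
4^pred≤self^self 1 = ≤-refl
4^pred≤self^self 2 = ≤-refl
4^pred≤self^self d@(suc (suc (suc _))) = <⇒≤ (4^pred<self^self d (s≤s (s≤s (s≤s z≤n))))

4^pred≡self^self : ∀ d → d ≤ 2 → d ^ d ≡ 4 ^ (d ∸ 1)
4^pred≡self^self 0 _ = refl
4^pred≡self^self 1 _ = refl
4^pred≡self^self 2 _ = refl
4^pred≡self^self (suc (suc (suc _))) (s≤s (s≤s ()))

ind-positive : ∀ {b} → 0 < ind b → b ≡ true
ind-positive {true} _ = refl

ind≤1 : ∀ b → ind b ≤ 1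
ind≤1 true  = ≤-refl
ind≤1 false = z≤n

ind<1 : ∀ {b} → ind b < 1 → b ≢ true
ind<1 (s≤s ()) refl

δ-≢ : ∀ {n} {y i : Fin n} → y ≢ i → δ y i ≡ 0
δ-≢ {y = y} {i} y≢i with y ≟ᶠ i
... | yes y≡i = contradiction y≡i y≢i
... | no  _   = refl

another : ∀ {n} → 2 ≤ n → (v : Fin n) → ∃ λ w → v ≢ w
another {suc zero} (s≤s ()) zero
another {suc (suc n)} _ zero    = suc zero , λ ()
another {suc (suc n)} _ (suc v) = zero , λ ()

degreeOf : ∀ {n} → (Fin n → Fin n → Bool) → Fin n → ℕ
degreeOf R v = ∑ (λ u → ind (R v u))

degree : ∀ {n} → SimpleGraph n → Fin n → ℕ
degree G = degreeOf (adj G)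

deg≡degree : ∀ {n} (G : SimpleGraph n) v → deg G v ≡ degree G v
deg≡degree G v = sum-allFin (λ u → ind (adj G v u))

≅-degree : ∀ {n} {G : SimpleGraph n} {H} (iso : G ≅ H) v →
           degree G v ≡ degreeOf H (Inverse.to (proj₁ iso) v)
≅-degree {H = H} (σ , σ-adj) v =
  trans (∑-cong (λ u → cong ind (sym (σ-adj v u))))
        (sym (Additive.∑-permute (λ u → ind (H (Inverse.to σ v) u)) σ))

≅-∑-degree : ∀ {n} {G : SimpleGraph n} {H} → G ≅ H → ∑ (degree G) ≡ ∑ (degreeOf H)
≅-∑-degree {G = G} {H} iso@(σ , _) =
  trans (∑-cong {f = degree G} (≅-degree {G = G} {H = H} iso)) (sym (Additive.∑-permute (degreeOf H) σ))

≅-∏-degree : ∀ {n} {G : SimpleGraph n} {H} → G ≅ H → ∏ (degree G) ≡ ∏ (degreeOf H)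
≅-∏-degree {G = G} {H} iso@(σ , _) =
  trans (∏-cong {f = degree G} (≅-degree {G = G} {H = H} iso)) (sym (Multiplicative.∑-permute (degreeOf H) σ))

module _ {n} (G : SimpleGraph n) where

  neighbour⇒1≤degree : ∀ {v y} → adj G v y ≡ true → 1 ≤ degree G v
  neighbour⇒1≤degree {v} {y} vy = subst (λ b → ind b ≤ degree G v) vy (term≤∑ (λ u → ind (adj G v u)) y)

  private
    neighbour-gain : ∀ {v y} → adj G v y ≡ true → 0 < ind (adj G v y)
    neighbour-gain vy rewrite vy = s≤s z≤n

  neighbours⇒2≤degree : ∀ {v y z} → y ≢ z → adj G v y ≡ true → adj G v z ≡ true → 2 ≤ degree G v
  neighbours⇒2≤degree {v} y≢z vy vz =
    subst (λ t → 2 + t ≤ degree G v) (∑-zero {n})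
      (∑-gain₂ (λ _ → z≤n) y≢z (neighbour-gain vy) (neighbour-gain vz))

  neighbours⇒3≤degree : ∀ {v y z w} → y ≢ z → w ≢ y → w ≢ z →
    adj G v y ≡ true → adj G v z ≡ true → adj G v w ≡ true → 3 ≤ degree G v
  neighbours⇒3≤degree {v} {y} {z} {w} y≢z w≢y w≢z vy vz vw =
    subst (λ t → 2 + t ≤ degree G v) (∑-δ w)
      (∑-gain₂ δ≤adj y≢z (subst (_< _) (sym (δ-≢ w≢y)) (neighbour-gain vy))
                          (subst (_< _) (sym (δ-≢ w≢z)) (neighbour-gain vz)))
    where
    δ≤adj : ∀ i → δ w i ≤ ind (adj G v i)
    δ≤adj i with w ≟ᶠ i
    ... | yes refl = neighbour-gain vw
    ... | no  _    = z≤n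

  unique-neighbour : ∀ {v y w} → degree G v ≤ 1 → adj G v y ≡ true → adj G v w ≡ true → w ≡ y
  unique-neighbour {y = y} {w = w} d≤1 vy vw with w ≟ᶠ y
  ... | yes w≡y = w≡y
  ... | no  w≢y = contradiction (≤-trans (neighbours⇒2≤degree w≢y vw vy) d≤1) 1+n≰n

  two-neighbours : ∀ {v y z w} → degree G v ≤ 2 → y ≢ z →
    adj G v y ≡ true → adj G v z ≡ true → adj G v w ≡ true → w ≡ y ⊎ w ≡ z
  two-neighbours {y = y} {z = z} {w = w} d≤2 y≢z vy vz vw with w ≟ᶠ y | w ≟ᶠ z
  ... | yes w≡y | _       = inj₁ w≡y
  ... | no  _   | yes w≡z = inj₂ w≡z
  ... | no  w≢y | no  w≢z = contradiction (≤-trans (neighbours⇒3≤degree y≢z w≢y w≢z vy vz vw) d≤2) 1+n≰n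

  dominating : ∀ {c v} → n ≤ suc (degree G c) → c ≢ v → adj G c v ≡ true
  dominating {c} {v} n≤1+dc c≢v with adj G c v in cv
  ... | true  = refl
  ... | false = contradiction (≤-trans (+-monoʳ-≤ 1 n≤1+dc) too-large) 1+n≰n
    where
    absent : ∀ {u} → adj G c u ≡ false → ind (adj G c u) < 1
    absent cu rewrite cu = s≤s z≤n
    too-large : 2 + degree G c ≤ n
    too-large = subst (2 + degree G c ≤_) (∑-one {n})
                  (∑-gain₂ (λ u → ind≤1 (adj G c u)) c≢v (absent (irrefl G c)) (absent cv))

  walk-leaves : ∀ {ℓ} {P : Pred (Fin n) ℓ} {S u w} → Decidable P → Walk G S u w → P u → ¬ P w →
                ∃ λ x → ∃ λ y → P x × ¬ P y × adj G x y ≡ true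
  walk-leaves P? (nil _) Pu ¬Pw = contradiction Pu ¬Pw
  walk-leaves P? (cons {u} {v} _ uv walk) Pu ¬Pw with P? v
  ... | yes Pv = walk-leaves P? walk Pv ¬Pw
  ... | no ¬Pv = u , v , Pu , ¬Pv , uv

  -- In a connected graph on at least two vertices, a walk to another vertex starts with
  -- an edge, so no vertex is isolated.
  connected⇒1≤degree : Connected G → 2 ≤ n → ∀ v → 1 ≤ degree G v
  connected⇒1≤degree conn 2≤n v =
    let w , v≢w = another 2≤n v
        x , y , x≡v , _ , xy = walk-leaves (_≟ᶠ v) (conn v w ∉⊥ ∉⊥) refl (v≢w ∘ sym)
    in neighbour⇒1≤degree (subst (λ t → adj G t y ≡ true) x≡v xy)

-- Vertex sets are Boolean functions; we grow them one vertex at a time.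
size : ∀ {n} → (Fin n → Bool) → ℕ
size s = ∑ (ind ∘ s)

insert : ∀ {n} → Fin n → (Fin n → Bool) → Fin n → Bool
insert y s i = does (y ≟ᶠ i) ∨ s i

insert-new : ∀ {n} (y : Fin n) s → insert y s y ≡ true
insert-new y s with y ≟ᶠ y
... | yes _   = refl
... | no  y≢y = contradiction refl y≢y

insert-old : ∀ {n} (y : Fin n) s {i} → s i ≡ true → insert y s i ≡ true
insert-old y s si = trans (cong (does (y ≟ᶠ _) ∨_) si) (∨-zeroʳ _)

size-insert : ∀ {n} (y : Fin n) s → s y ≡ false → size (insert y s) ≡ suc (size s)
size-insert y s sy = begin
  size (insert y s)                ≡⟨ ∑-cong split ⟩
  ∑ (λ i → δ y i + ind (s i))      ≡⟨ Additive.∑-distrib-+ (δ y) (ind ∘ s) ⟩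
  ∑ (δ y) + size s                 ≡⟨ cong (_+ size s) (∑-δ y) ⟩
  suc (size s)                     ∎
  where
  open ≡-Reasoning
  split : ∀ i → ind (insert y s i) ≡ δ y i + ind (s i)
  split i with y ≟ᶠ i
  ... | yes refl rewrite sy = refl
  ... | no  _    = refl

size<n⇒missing : ∀ {n} (s : Fin n → Bool) → size s < n → ∃ λ w → s w ≢ true
size<n⇒missing {n} s small =
  let w , sw<1 = ∑<⇒∃< (ind ∘ s) (λ _ → 1) (subst (size s <_) (sym (∑-one {n})) small)
  in w , ind<1 sw<1

size>0⇒member : ∀ {n} (s : Fin n → Bool) → 0 < size s → ∃ λ u → s u ≡ true
size>0⇒member {n} s nonempty =
  let u , 0<su = ∑<⇒∃< (λ _ → 0) (ind ∘ s) (subst (_< size s) (sym (∑-zero {n})) nonempty)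
  in u , ind-positive 0<su

ind-∧-mono : ∀ {a a′ b b′} c → (a ≡ true → a′ ≡ true) → (b ≡ true → b′ ≡ true) →
             ind (a ∧ b ∧ c) ≤ ind (a′ ∧ b′ ∧ c)
ind-∧-mono {false}             c _ _ = z≤n
ind-∧-mono {true} {b = false}  c _ _ = z≤n
ind-∧-mono {true} {b = true}   c a→ b→ rewrite a→ refl | b→ refl = ≤-refl

ind-∧-absent : ∀ a b c → a ≡ false ⊎ b ≡ false → ind (a ∧ b ∧ c) ≡ 0
ind-∧-absent false b     c _ = refl
ind-∧-absent true  false c _ = refl
ind-∧-absent true  true  c (inj₁ ())
ind-∧-absent true  true  c (inj₂ ())

ind-∧-≤ : ∀ a b c → ind (a ∧ b ∧ c) ≤ ind c
ind-∧-≤ a b c = ind-∧-mono {a} {true} {b} {true} c (λ _ → refl) (λ _ → refl)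

module _ {n} (G : SimpleGraph n) where

  -- Twice the number of edges of G inside the vertex set s.
  inner : (Fin n → Bool) → ℕ
  inner s = ∑ λ i → ∑ λ j → ind (s i ∧ s j ∧ adj G i j)

  inner≤degree-sum : ∀ s → inner s ≤ ∑ (degree G)
  inner≤degree-sum s = ∑-mono λ i → ∑-mono λ j → ind-∧-≤ (s i) (s j) (adj G i j)

  inner-insert : ∀ s {x y} → s x ≡ true → s y ≡ false → adj G x y ≡ true →
                 2 + inner s ≤ inner (insert y s)
  inner-insert s {x} {y} sx sy xy =
    ∑-gain₂ (λ i → ∑-mono (cell-mono i)) x≢y
      (∑-gain (cell-mono x) y (new-cell (inj₂ sy) sx′ (insert-new y s) xy))
      (∑-gain (cell-mono y) x (new-cell (inj₁ sy) (insert-new y s) sx′ (trans (adj-sym G y x) xy)))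
    where
    s′ = insert y s
    sx′ = insert-old y s sx
    x≢y : x ≢ y
    x≢y refl = contradiction (trans (sym sx) sy) (λ ())
    cell-mono : ∀ i j → ind (s i ∧ s j ∧ adj G i j) ≤ ind (s′ i ∧ s′ j ∧ adj G i j)
    cell-mono i j = ind-∧-mono (adj G i j) (insert-old y s) (insert-old y s)
    new-cell : ∀ {i j} → s i ≡ false ⊎ s j ≡ false → s′ i ≡ true → s′ j ≡ true → adj G i j ≡ true →
               ind (s i ∧ s j ∧ adj G i j) < ind (s′ i ∧ s′ j ∧ adj G i j)
    new-cell {i} {j} absent si′ sj′ ij rewrite ind-∧-absent (s i) (s j) (adj G i j) absent | si′ | sj′ | ij = s≤s z≤n

  -- Growing a set along edges: in a connected graph, for each t < n some set of
  -- t + 1 vertices spans at least t edges.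
  grow : Connected G → ∀ t → t < n → ∃ λ s → size s ≡ suc t × 2 * t ≤ inner s
  grow conn zero 0<n = insert v (λ _ → false) , trans (size-insert v _ refl) (cong suc (∑-zero {n})) , z≤n
    where v = fromℕ< 0<n
  grow conn (suc t) t+1<n
    with s , size≡ , bound ← grow conn t (<-trans (n<1+n t) t+1<n)
    with w , w∉s ← size<n⇒missing s (subst (_< n) (sym size≡) t+1<n)
    with u , u∈s ← size>0⇒member s (subst (0 <_) (sym size≡) (s≤s z≤n))
    with x , y , x∈s , y∉s , xy ← walk-leaves G (λ i → s i Bool.≟ true) (conn u w ∉⊥ ∉⊥) u∈s w∉s
    = insert y s
    , trans (size-insert y s (¬-not y∉s)) (cong suc size≡)
    , ≤-trans (≤-reflexive (*-suc 2 t)) (≤-trans (+-monoʳ-≤ 2 bound) (inner-insert s x∈s (¬-not y∉s) xy))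

connected⇒2m≤degree-sum : ∀ {m} (G : SimpleGraph (suc m)) → Connected G → 2 * m ≤ ∑ (degree G)
connected⇒2m≤degree-sum {m} G conn =
  let s , _ , bound = grow G conn m ≤-refl in ≤-trans bound (inner≤degree-sum G s)

<ᵇ-irrefl : ∀ m → (m <ᵇ m) ≡ false
<ᵇ-irrefl zero    = refl
<ᵇ-irrefl (suc m) = <ᵇ-irrefl m

<ᵇ-connex : ∀ m n → m ≢ n → (m <ᵇ n) xor (n <ᵇ m) ≡ true
<ᵇ-connex zero    zero    m≢n = contradiction refl m≢n
<ᵇ-connex zero    (suc n) _   = refl
<ᵇ-connex (suc m) zero    _   = refl
<ᵇ-connex (suc m) (suc n) m≢n = <ᵇ-connex m n (m≢n ∘ cong suc)

ind-split : ∀ p q c → p xor q ≡ true → ind (p ∧ c) + ind (q ∧ c) ≡ ind c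
ind-split true  false c _ = +-identityʳ (ind c)
ind-split false true  c _ = refl

edge-factor : ∀ b x y → (if b then x * y else 1) ≡ x ^ ind b * y ^ ind b
edge-factor true  x y = sym (cong₂ _*_ (*-identityʳ x) (*-identityʳ y))
edge-factor false x y = refl

∏-pairs : ∀ {n} (f : Fin n → ℕ) (w : Fin n → Fin n → ℕ) →
          ∏ (λ u → ∏ (λ v → f u ^ w u v * f v ^ w u v)) ≡ ∏ (λ u → f u ^ ∑ (λ v → w u v + w v u))
∏-pairs f w = begin
  ∏ (λ u → ∏ (λ v → f u ^ w u v * f v ^ w u v))
    ≡⟨ ∏-cong (λ u → Multiplicative.∑-distrib-+ (λ v → f u ^ w u v) (λ v → f v ^ w u v)) ⟩
  ∏ (λ u → ∏ (λ v → f u ^ w u v) * ∏ (λ v → f v ^ w u v))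
    ≡⟨ Multiplicative.∑-distrib-+ (λ u → ∏ (λ v → f u ^ w u v)) (λ u → ∏ (λ v → f v ^ w u v)) ⟩
  ∏ (λ u → ∏ (λ v → f u ^ w u v)) * ∏ (λ u → ∏ (λ v → f v ^ w u v))
    ≡⟨ cong₂ _*_ (∏-cong (λ u → ∏-pow (f u) (w u)))
                 (trans (Multiplicative.∑-comm (λ u v → f v ^ w u v)) (∏-cong (λ v → ∏-pow (f v) (λ u → w u v)))) ⟩
  ∏ (λ u → f u ^ ∑ (w u)) * ∏ (λ u → f u ^ ∑ (λ v → w v u))
    ≡⟨ Multiplicative.∑-distrib-+ (λ u → f u ^ ∑ (w u)) (λ u → f u ^ ∑ (λ v → w v u)) ⟨
  ∏ (λ u → f u ^ ∑ (w u) * f u ^ ∑ (λ v → w v u))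
    ≡⟨ ∏-cong (λ u → trans (cong (f u ^_) (Additive.∑-distrib-+ (w u) (λ v → w v u)))
                           (^-distribˡ-+-* (f u) (∑ (w u)) (∑ (λ v → w v u)))) ⟨
  ∏ (λ u → f u ^ ∑ (λ v → w u v + w v u)) ∎
  where open ≡-Reasoning

module _ {n} (G : SimpleGraph n) where

  Π₁≡ : Π₁ G ≡ ∏ (degree G) ^ 2
  Π₁≡ = trans (product-allFin (λ u → deg G u ^ 2))
              (trans (∏-cong (λ u → cong (_^ 2) (deg≡degree G u))) (∏-^ (degree G) 2))

  before : Fin n → Fin n → Bool
  before u v = (toℕ u <ᵇ toℕ v) ∧ adj G u v

  edge-once : ∀ u v → ind (before u v) + ind (before v u) ≡ ind (adj G u v)
  edge-once u v with u ≟ᶠ v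
  ... | yes refl rewrite <ᵇ-irrefl (toℕ u) | irrefl G u = refl
  ... | no  u≢v rewrite adj-sym G v u =
    ind-split (toℕ u <ᵇ toℕ v) (toℕ v <ᵇ toℕ u) (adj G u v) (<ᵇ-connex (toℕ u) (toℕ v) (u≢v ∘ toℕ-injective))

  Π₂≡ : Π₂ G ≡ ∏ (λ u → degree G u ^ degree G u)
  Π₂≡ = begin
    Π₂ G
      ≡⟨ trans (product-allFin (λ u → product (map (edge-term u) (allFin n))))
               (∏-cong (λ u → product-allFin (edge-term u))) ⟩
    ∏ (λ u → ∏ (edge-term u))
      ≡⟨ ∏-cong (λ u → ∏-cong (λ v → trans (edge-factor (before u v) (deg G u) (deg G v))
                                            (cong₂ (λ x y → x ^ ind (before u v) * y ^ ind (before u v))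
                                                   (deg≡degree G u) (deg≡degree G v)))) ⟩
    ∏ (λ u → ∏ (λ v → degree G u ^ ind (before u v) * degree G v ^ ind (before u v)))
      ≡⟨ ∏-pairs (degree G) (λ u v → ind (before u v)) ⟩
    ∏ (λ u → degree G u ^ ∑ (λ v → ind (before u v) + ind (before v u)))
      ≡⟨ ∏-cong (λ u → cong (degree G u ^_) (∑-cong (edge-once u))) ⟩
    ∏ (λ u → degree G u ^ degree G u) ∎
    where
    open ≡-Reasoning
    edge-term : Fin n → Fin n → ℕ
    edge-term u v = if before u v then deg G u * deg G v else 1

star-degree-hub : ∀ {k} → degreeOf (starAdj {suc k}) zero ≡ k
star-degree-hub {k} = ∑-one {k}

star-degree-leaf : ∀ {k} (i : Fin k) → degreeOf (starAdj {suc k}) (suc i) ≡ 1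
star-degree-leaf {k} i = cong suc (∑-zero {k})

star-degree-product : ∀ {k} → ∏ (degreeOf (starAdj {suc k})) ≡ k
star-degree-product {k} =
  trans (cong₂ _*_ (star-degree-hub {k}) (trans (∏-cong {k} star-degree-leaf) (Multiplicative.sum-replicate-zero k)))
        (*-identityʳ k)

nonzero⇒≢ᵇ0 : ∀ {k} (c : Fin (suc k)) → c ≢ zero → (toℕ c ≡ᵇ 0) ≡ false
nonzero⇒≢ᵇ0 zero    c≢0 = contradiction refl c≢0
nonzero⇒≢ᵇ0 (suc c) _   = refl

hub-to-zero : ∀ {k} (c v : Fin (suc k)) → (toℕ (transpose c zero ⟨$⟩ʳ v) ≡ᵇ 0) ≡ does (v ≟ᶠ c)
hub-to-zero c v with v ≟ᶠ c
... | yes refl = refl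
... | no  v≢c with v ≟ᶠ zero
...   | yes refl = nonzero⇒≢ᵇ0 c (v≢c ∘ sym)
...   | no  v≢0  = nonzero⇒≢ᵇ0 v v≢0

star-recognition : ∀ {k} (G : SimpleGraph (suc k)) c →
  (∀ v → v ≢ c → adj G c v ≡ true) → (∀ v w → v ≢ c → w ≢ c → adj G v w ≡ false) → G ≅ starAdj
star-recognition G c hub no-other-edge =
  transpose c zero , λ i j → trans (cong₂ _xor_ (hub-to-zero c i) (hub-to-zero c j)) (by-cases i j)
  where
  by-cases : ∀ i j → does (i ≟ᶠ c) xor does (j ≟ᶠ c) ≡ adj G i j
  by-cases i j with i ≟ᶠ c | j ≟ᶠ c
  ... | yes refl | yes refl = sym (irrefl G i)
  ... | yes refl | no  j≢c  = sym (hub j j≢c)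
  ... | no  i≢c  | yes refl = sym (trans (adj-sym G i j) (hub i i≢c))
  ... | no  i≢c  | no  j≢c  = sym (no-other-edge i j i≢c j≢c)

≡ᵇ-sym : ∀ a b → (a ≡ᵇ b) ≡ (b ≡ᵇ a)
≡ᵇ-sym zero    zero    = refl
≡ᵇ-sym zero    (suc b) = refl
≡ᵇ-sym (suc a) zero    = refl
≡ᵇ-sym (suc a) (suc b) = ≡ᵇ-sym a b

ind-∨ : ∀ p q → ind (p ∨ q) ≤ ind p + ind q
ind-∨ true  q = s≤s z≤n
ind-∨ false q = ≤-refl

count≤1 : ∀ {n} a → ∑ {n} (λ j → ind (a ≡ᵇ toℕ j)) ≤ 1
count≤1 {zero}  a       = z≤n
count≤1 {suc n} zero    = ≤-reflexive (cong suc (∑-zero {n}))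
count≤1 {suc n} (suc a) = count≤1 {n} a

count-absent : ∀ {n} a → n ≤ a → ∑ {n} (λ j → ind (a ≡ᵇ toℕ j)) ≡ 0
count-absent {zero}  a       _         = refl
count-absent {suc n} (suc a) (s≤s n≤a) = count-absent {n} a n≤a

successors predecessors : ∀ {n} → Fin n → ℕ
successors   {n} v = ∑ {n} (λ j → ind (suc (toℕ v) ≡ᵇ toℕ j))
predecessors {n} v = ∑ {n} (λ j → ind (toℕ v ≡ᵇ suc (toℕ j)))

path-degree-split : ∀ {n} (v : Fin n) → degreeOf pathAdj v ≤ successors v + predecessors v
path-degree-split {n} v = begin
  degreeOf pathAdj v
    ≤⟨ ∑-mono {n} (λ j → ind-∨ (suc (toℕ v) ≡ᵇ toℕ j) (suc (toℕ j) ≡ᵇ toℕ v)) ⟩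
  ∑ {n} (λ j → ind (suc (toℕ v) ≡ᵇ toℕ j) + ind (suc (toℕ j) ≡ᵇ toℕ v))
    ≡⟨ Additive.∑-distrib-+ {n} (λ j → ind (suc (toℕ v) ≡ᵇ toℕ j)) (λ j → ind (suc (toℕ j) ≡ᵇ toℕ v)) ⟩
  successors v + ∑ {n} (λ j → ind (suc (toℕ j) ≡ᵇ toℕ v))
    ≡⟨ cong (successors v +_) (∑-cong {n} (λ j → cong ind (≡ᵇ-sym (suc (toℕ j)) (toℕ v)))) ⟩
  successors v + predecessors v ∎
  where open ≤-Reasoning

predecessors≤1 : ∀ {n} (v : Fin n) → predecessors v ≤ 1
predecessors≤1 {n} v = ≤-trans (m≤n+m _ (ind (toℕ v ≡ᵇ 0))) (count≤1 {suc n} (toℕ v))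

path-degree≤2 : ∀ {n} (v : Fin n) → degreeOf pathAdj v ≤ 2
path-degree≤2 {n} v = ≤-trans (path-degree-split v) (+-mono-≤ (count≤1 {n} (suc (toℕ v))) (predecessors≤1 v))

path-degree-first : ∀ {n} → degreeOf (pathAdj {suc n}) zero ≤ 1
path-degree-first {n} = begin
  degreeOf (pathAdj {suc n}) zero  ≤⟨ path-degree-split {suc n} zero ⟩
  successors {suc n} zero + preds  ≡⟨ cong (successors {suc n} zero +_) (∑-zero {suc n}) ⟩
  successors {suc n} zero + 0      ≡⟨ +-identityʳ (successors {suc n} zero) ⟩
  successors {suc n} zero          ≤⟨ count≤1 {suc n} 1 ⟩
  1                                ∎
  where
  open ≤-Reasoning
  preds = predecessors {suc n} zero

path-degree-last : ∀ {n} → degreeOf (pathAdj {suc n}) (fromℕ n) ≤ 1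
path-degree-last {n} = ≤-trans (path-degree-split (fromℕ n))
  (subst (λ t → t + predecessors (fromℕ n) ≤ 1) (sym no-successor) (predecessors≤1 (fromℕ n)))
  where
  no-successor : successors (fromℕ n) ≡ 0
  no-successor = trans (∑-cong {suc n} (λ j → cong (λ t → ind (suc t ≡ᵇ toℕ j)) (toℕ-fromℕ n)))
                       (count-absent {suc n} (suc n) ≤-refl)

≡ᵇ-sound : ∀ {m n} → (m ≡ᵇ n) ≡ true → m ≡ n
≡ᵇ-sound {m} {n} e = ≡ᵇ⇒≡ m n (Equivalence.from T-≡ e)

≡ᵇ-complete : ∀ {m n} → m ≡ n → (m ≡ᵇ n) ≡ true
≡ᵇ-complete {m} {n} e = Equivalence.to T-≡ (≡⇒≡ᵇ m n e)

path-step⇔ : ∀ {n} (i j : Fin n) → pathAdj i j ≡ true ⇔ (suc (toℕ i) ≡ toℕ j ⊎ suc (toℕ j) ≡ toℕ i)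
path-step⇔ i j = mk⇔ to from
  where
  to : pathAdj i j ≡ true → suc (toℕ i) ≡ toℕ j ⊎ suc (toℕ j) ≡ toℕ i
  to e with suc (toℕ i) ≡ᵇ toℕ j in forward
  ... | true  = inj₁ (≡ᵇ-sound forward)
  ... | false = inj₂ (≡ᵇ-sound e)
  from : suc (toℕ i) ≡ toℕ j ⊎ suc (toℕ j) ≡ toℕ i → pathAdj i j ≡ true
  from (inj₁ forward)  = cong (_∨ (suc (toℕ j) ≡ᵇ toℕ i)) (≡ᵇ-complete forward)
  from (inj₂ backward) = trans (cong ((suc (toℕ i) ≡ᵇ toℕ j) ∨_) (≡ᵇ-complete backward)) (∨-zeroʳ _)

injective⇒onto : ∀ {n} (f : Fin n → Fin n) → (∀ {i j} → f i ≡ f j → i ≡ j) → ∀ z → ∃ λ i → f i ≡ z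
injective⇒onto {suc n} f f-inj z with any? (λ i → f i ≟ᶠ z)
... | yes found   = found
... | no  missing = contradiction (injective⇒≤ avoid-z-injective) 1+n≰n
  where
  avoid-z : Fin (suc n) → Fin n
  avoid-z i = punchOut {i = z} {j = f i} (λ z≡fi → missing (i , sym z≡fi))
  avoid-z-injective : ∀ {i j} → avoid-z i ≡ avoid-z j → i ≡ j
  avoid-z-injective {i} {j} eq = f-inj (punchOut-injective {i = z} {j = f i} {k = f j} _ _ eq)

pick : ∀ {n ℓ} {P : Pred (Fin n) ℓ} → Decidable P → Fin n → Fin n
pick P? default with any? P?
... | yes (i , _) = i
... | no  _       = default

pick-satisfies : ∀ {n ℓ} {P : Pred (Fin n) ℓ} (P? : Decidable P) default → ∃ P → P (pick P? default)
pick-satisfies P? default ∃P with any? P?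
... | yes (_ , Pi) = Pi
... | no  ¬∃P      = contradiction ∃P ¬∃P

-- A connected graph of maximum degree 2 with a vertex a of degree ≤ 1 is a path
-- starting at a: walk away from a, never stepping back to the vertex just left.
module PathFrom {M} (G : SimpleGraph (suc M)) (conn : Connected G)
                (degree≤2 : ∀ v → degree G v ≤ 2) (a : Fin (suc M)) (a-end : degree G a ≤ 1) where

  away? : (prev cur : Fin (suc M)) → Decidable (λ w → adj G cur w ≡ true × w ≢ prev)
  away? prev cur w = (adj G cur w Bool.≟ true) ×-dec ¬? (w ≟ᶠ prev)

  -- The walk state: (previous vertex, current vertex).
  state : ℕ → Fin (suc M) × Fin (suc M)
  state zero    = a , a
  state (suc k) = proj₂ (state k) , pick (away? (proj₁ (state k)) (proj₂ (state k))) (proj₂ (state k))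

  x : ℕ → Fin (suc M)
  x k = proj₂ (state k)

  previous : ∀ k → proj₁ (state k) ≡ x (k ∸ 1)
  previous zero    = refl
  previous (suc k) = refl

  record IsPath (k : ℕ) : Set where
    field
      steps    : ∀ {p} → p < k → adj G (x p) (x (suc p)) ≡ true
      distinct : ∀ {p q} → p ≤ k → q ≤ k → x p ≡ x q → p ≡ q

  module _ {k} (path : IsPath k) where
    open IsPath path

    -- By the degree bounds, a vertex before the end of the path has no neighbours
    -- besides its neighbours on the path.
    neighbour-along : ∀ {p y} → p < k → adj G (x p) y ≡ true → y ≡ x (suc p) ⊎ ∃ λ q → p ≡ suc q × y ≡ x q
    neighbour-along {zero}  0<k xy = inj₁ (unique-neighbour G a-end (steps 0<k) xy)
    neighbour-along {suc q} p<k xy =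
      Sum.map id (λ y≡back → q , refl , y≡back)
        (two-neighbours G (degree≤2 _) forth≢back (steps p<k) back xy)
      where
      q<k = <-trans (n<1+n q) p<k
      back : adj G (x (suc q)) (x q) ≡ true
      back = trans (adj-sym G _ _) (steps q<k)
      forth≢back : x (suc (suc q)) ≢ x q
      forth≢back eq = contradiction (distinct p<k (<⇒≤ q<k) eq) (λ ())

    forward-adjacent : ∀ {p q} → p < q → q ≤ k → adj G (x p) (x q) ≡ true → suc p ≡ q
    forward-adjacent {p} {q} p<q q≤k xy with neighbour-along (<-≤-trans p<q q≤k) xy
    ... | inj₁ y≡next           = sym (distinct q≤k (<-≤-trans p<q q≤k) y≡next)
    ... | inj₂ (r , refl , y≡r) = contradiction (distinct q≤k (≤-trans (n≤1+n r) (<⇒≤ (<-≤-trans p<q q≤k))) y≡r)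
                                                (λ q≡r → <-asym p<q (subst (_< suc r) (sym q≡r) (n<1+n r)))

    prefix-adjacent : ∀ {p q} → p ≤ k → q ≤ k → adj G (x p) (x q) ≡ true → suc p ≡ q ⊎ suc q ≡ p
    prefix-adjacent {p} {q} p≤k q≤k xy with <-cmp p q
    ... | tri< p<q _ _  = inj₁ (forward-adjacent p<q q≤k xy)
    ... | tri≈ _ refl _ = contradiction (trans (sym xy) (irrefl G (x p))) (λ ())
    ... | tri> _ _ q<p  = inj₂ (forward-adjacent q<p p≤k (trans (adj-sym G _ _) xy))

    OnPath : Fin (suc M) → Set
    OnPath z = ∃ λ q → q < suc k × x q ≡ z

    onPath? : Decidable OnPath
    onPath? z = anyUpTo? (λ q → x q ≟ᶠ z) (suc k)

    uncovered : suc k < suc M → ∃ λ z → ¬ OnPath z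
    uncovered k+1<n with any? (¬? ∘ onPath?)
    ... | yes found = found
    ... | no  none  = contradiction (injective⇒≤ position-injective) (<⇒≱ k+1<n)
      where
      covered : ∀ z → OnPath z
      covered z = decidable-stable (onPath? z) (λ z∉ → none (z , z∉))
      position : Fin (suc M) → Fin (suc k)
      position z = fromℕ< (proj₁ (proj₂ (covered z)))
      position-injective : ∀ {z z′} → position z ≡ position z′ → z ≡ z′
      position-injective {z} {z′} eq = begin
        z                             ≡⟨ proj₂ (proj₂ (covered z)) ⟨
        x (proj₁ (covered z))         ≡⟨ cong x (trans (sym (toℕ-fromℕ< _)) (trans (cong toℕ eq) (toℕ-fromℕ< _))) ⟩
        x (proj₁ (covered z′))        ≡⟨ proj₂ (proj₂ (covered z′)) ⟩
        z′                            ∎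
        where open ≡-Reasoning

    -- Connectivity: an edge leaves the path, and it can only leave from the end x k.
    fresh-neighbour : suc k < suc M → ∃ λ w → adj G (x k) w ≡ true × ¬ OnPath w
    fresh-neighbour k+1<n
      with z , z∉ ← uncovered k+1<n
      with u , w , (p , p<k+1 , xp≡u) , w∉ , uw ← walk-leaves G onPath? (conn a z ∉⊥ ∉⊥) (0 , s≤s z≤n , refl) z∉
      with m≤n⇒m<n∨m≡n (s≤s⁻¹ p<k+1)
    ... | inj₂ refl = w , subst (λ v → adj G v w ≡ true) (sym xp≡u) uw , w∉
    ... | inj₁ p<k with neighbour-along p<k (subst (λ v → adj G v w ≡ true) (sym xp≡u) uw)
    ...   | inj₁ w≡next          = contradiction (suc p , s≤s p<k , sym w≡next) w∉
    ...   | inj₂ (q , refl , w≡q) = contradiction (q , <-trans (n<1+n q) (s≤s (<⇒≤ p<k)) , sym w≡q) w∉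

    extend : suc k < suc M → IsPath (suc k)
    extend k+1<n = record { steps = steps′ ; distinct = distinct′ }
      where
      next-ok : adj G (x k) (x (suc k)) ≡ true × x (suc k) ≢ proj₁ (state k)
      next-ok = pick-satisfies (away? (proj₁ (state k)) (x k)) (x k)
        (let w , kw , w∉ = fresh-neighbour k+1<n
         in w , kw , λ w≡prev → w∉ (k ∸ 1 , s≤s (m∸n≤m k 1) , sym (trans w≡prev (previous k))))
      new : ∀ {q} → q ≤ k → x q ≢ x (suc k)
      new {q} q≤k xq≡new with prefix-adjacent ≤-refl q≤k (subst (λ v → adj G (x k) v ≡ true) (sym xq≡new) (proj₁ next-ok))
      ... | inj₁ refl = 1+n≰n q≤k
      ... | inj₂ q+1≡k = proj₂ next-ok (trans (sym xq≡new) (trans (cong x (cong (_∸ 1) q+1≡k)) (sym (previous k))))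
      steps′ : ∀ {p} → p < suc k → adj G (x p) (x (suc p)) ≡ true
      steps′ p<k+1 with m≤n⇒m<n∨m≡n (s≤s⁻¹ p<k+1)
      ... | inj₁ p<k  = steps p<k
      ... | inj₂ refl = proj₁ next-ok
      distinct′ : ∀ {p q} → p ≤ suc k → q ≤ suc k → x p ≡ x q → p ≡ q
      distinct′ p≤ q≤ eq with m≤n⇒m<n∨m≡n p≤ | m≤n⇒m<n∨m≡n q≤
      ... | inj₁ p<  | inj₁ q<  = distinct (s≤s⁻¹ p<) (s≤s⁻¹ q<) eq
      ... | inj₁ p<  | inj₂ refl = contradiction eq (new (s≤s⁻¹ p<))
      ... | inj₂ refl | inj₁ q<  = contradiction (sym eq) (new (s≤s⁻¹ q<))
      ... | inj₂ refl | inj₂ refl = refl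

  path : ∀ k → k ≤ M → IsPath k
  path zero    _     = record { steps = λ () ; distinct = λ { z≤n z≤n _ → refl } }
  path (suc k) k+1≤M = extend (path k (≤-trans (n≤1+n k) k+1≤M)) (s≤s k+1≤M)

  complete : IsPath M
  complete = path M ≤-refl

  open IsPath complete

  vertex-at : Fin (suc M) → Fin (suc M)
  vertex-at i = x (toℕ i)

  vertex-at-injective : ∀ {i j} → vertex-at i ≡ vertex-at j → i ≡ j
  vertex-at-injective {i} {j} eq = toℕ-injective (distinct (toℕ≤pred[n] i) (toℕ≤pred[n] j) eq)

  -- Every vertex is visited, so the numbering can be inverted.
  position : Fin (suc M) → Fin (suc M)
  position v = proj₁ (injective⇒onto vertex-at vertex-at-injective v)

  vertex-at-position : ∀ v → vertex-at (position v) ≡ v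
  vertex-at-position v = proj₂ (injective⇒onto vertex-at vertex-at-injective v)

  path-adjacency : ∀ i j → pathAdj i j ≡ adj G (vertex-at i) (vertex-at j)
  path-adjacency i j = ⇔→≡ {z = true} (mk⇔ consecutive⇒adjacent adjacent⇒consecutive)
    where
    consecutive⇒adjacent : pathAdj i j ≡ true → adj G (vertex-at i) (vertex-at j) ≡ true
    consecutive⇒adjacent ij with Equivalence.to (path-step⇔ i j) ij
    ... | inj₁ i+1≡j = subst (λ q → adj G (vertex-at i) (x q) ≡ true) i+1≡j
                         (steps (subst (_≤ M) (sym i+1≡j) (toℕ≤pred[n] j)))
    ... | inj₂ j+1≡i = trans (adj-sym G _ _) (subst (λ q → adj G (vertex-at j) (x q) ≡ true) j+1≡i
                         (steps (subst (_≤ M) (sym j+1≡i) (toℕ≤pred[n] i))))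
    adjacent⇒consecutive : adj G (vertex-at i) (vertex-at j) ≡ true → pathAdj i j ≡ true
    adjacent⇒consecutive = Equivalence.from (path-step⇔ i j) ∘ prefix-adjacent complete (toℕ≤pred[n] i) (toℕ≤pred[n] j)

  iso : G ≅ pathAdj
  iso = mk↔ₛ′ position vertex-at (λ i → vertex-at-injective (vertex-at-position (vertex-at i))) vertex-at-position
      , λ i j → trans (path-adjacency (position i) (position j)) (cong₂ (adj G) (vertex-at-position i) (vertex-at-position j))

module ConnectedGraph {m} (G : SimpleGraph (2 + m)) (conn : Connected G) where

  d : Fin (2 + m) → ℕ
  d = degree G

  excess : Fin (2 + m) → ℕ
  excess v = d v ∸ 1

  d≡1+excess : ∀ v → d v ≡ suc (excess v)
  d≡1+excess v = sym (suc-∸1 (connected⇒1≤degree G conn (s≤s (s≤s z≤n)) v))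

  degree-sum : ∑ d ≡ 2 + m + ∑ excess
  degree-sum = trans (∑-cong d≡1+excess) (∑-suc excess)

  m≤∑excess : m ≤ ∑ excess
  m≤∑excess = +-cancelˡ-≤ (2 + m) m (∑ excess) (begin
    2 + m + m          ≡⟨ solve 1 (λ m → con 2 :+ m :+ m := con 2 :* (con 1 :+ m)) refl m ⟩
    2 * suc m          ≤⟨ connected⇒2m≤degree-sum G conn ⟩
    ∑ d                ≡⟨ degree-sum ⟩
    2 + m + ∑ excess   ∎)
    where open ≤-Reasoning

  1+excess : Fin (2 + m) → ℕ
  1+excess v = suc (excess v)

  ∏d≡ : ∏ d ≡ ∏ 1+excess
  ∏d≡ = ∏-cong d≡1+excess

  Π₁-lower : (1 + m) ^ 2 ≤ Π₁ G
  Π₁-lower = begin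
    (1 + m) ^ 2              ≤⟨ ^-monoˡ-≤ 2 (≤-trans (s≤s m≤∑excess) (1+∑≤∏suc excess)) ⟩
    ∏ 1+excess ^ 2     ≡⟨ cong (_^ 2) ∏d≡ ⟨
    ∏ d ^ 2                  ≡⟨ Π₁≡ G ⟨
    Π₁ G                     ∎
    where open ≤-Reasoning

  star-from-excess : ∑ excess ≡ m → (∀ i j → i ≢ j → excess i * excess j ≡ 0) → G ≅ starAdj
  star-from-excess ∑≡m disjoint = star-recognition G c hub no-other-edge
    where
    centre : ∃ λ c → ∀ i → i ≢ c → excess i ≡ 0
    centre with any? (λ i → 1 ≤? excess i)
    ... | yes (c , 1≤ec) = c , λ i i≢c → Sum.[ (λ ec≡0 → contradiction (subst (1 ≤_) ec≡0 1≤ec) λ ()) , id ]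
                                           (m*n≡0⇒m≡0∨n≡0 (excess c) (disjoint c i (i≢c ∘ sym)))
    ... | no  none       = zero , λ i _ → n≤0⇒n≡0 (≮⇒≥ (λ 0<ei → none (i , 0<ei)))
    c = proj₁ centre
    d-leaf : ∀ v → v ≢ c → d v ≡ 1
    d-leaf v v≢c = trans (d≡1+excess v) (cong suc (proj₂ centre v v≢c))
    d-centre : d c ≡ suc m
    d-centre = trans (d≡1+excess c) (cong suc (trans (sym (∑-single excess c (proj₂ centre))) ∑≡m))
    hub : ∀ v → v ≢ c → adj G c v ≡ true
    hub v v≢c = dominating G (≤-reflexive (cong suc (sym d-centre))) (v≢c ∘ sym)
    no-other-edge : ∀ v w → v ≢ c → w ≢ c → adj G v w ≡ false
    no-other-edge v w v≢c w≢c with adj G v w in vw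
    ... | false = refl
    ... | true  = contradiction (unique-neighbour G (≤-reflexive (d-leaf v v≢c)) (trans (adj-sym G v c) (hub v v≢c)) vw) w≢c

  -- Equality Π₁(G) = (n-1)² forces ∑ excess = m and no two vertices of positive excess.
  Π₁-extremal⇒star : Π₁ G ≡ (1 + m) ^ 2 → G ≅ starAdj
  Π₁-extremal⇒star extremal = star-from-excess ∑≡m (λ i j i≢j → n≤0⇒n≡0 (+-cancelˡ-≤ (suc (∑ excess)) _ 0 (cross i≢j)))
    where
    ∏≤ : ∏ 1+excess ≤ suc m
    ∏≤ = ^-cancelˡ-≤ 1 (subst₂ _≤_ (trans (Π₁≡ G) (cong (_^ 2) ∏d≡)) extremal ≤-refl)
    ∑≡m : ∑ excess ≡ m
    ∑≡m = ≤-antisym (s≤s⁻¹ (≤-trans (1+∑≤∏suc excess) ∏≤)) m≤∑excess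
    cross : ∀ {i j} → i ≢ j → suc (∑ excess) + excess i * excess j ≤ suc (∑ excess) + 0
    cross {i} {j} i≢j = begin
      suc (∑ excess) + excess i * excess j  ≤⟨ cross-term≤∏suc excess i≢j ⟩
      ∏ 1+excess                            ≤⟨ ∏≤ ⟩
      suc m                                 ≡⟨ cong suc (sym ∑≡m) ⟩
      suc (∑ excess)                        ≡⟨ +-identityʳ _ ⟨
      suc (∑ excess) + 0                    ∎
      where open ≤-Reasoning

  -- The degrees of Sₙ multiply to n - 1.
  star⇒Π₁-extremal : G ≅ starAdj → Π₁ G ≡ (1 + m) ^ 2
  star⇒Π₁-extremal iso = trans (Π₁≡ G) (cong (_^ 2) (trans (≅-∏-degree {G = G} {H = starAdj} iso) (star-degree-product {suc m})))

  Π₂-lower : 4 ^ m ≤ Π₂ G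
  Π₂-lower = begin
    4 ^ m                    ≤⟨ ^-monoʳ-≤ 4 m≤∑excess ⟩
    4 ^ ∑ excess             ≡⟨ ∏-pow 4 excess ⟨
    ∏ (λ v → 4 ^ excess v)   ≤⟨ ∏-mono (λ v → 4^pred≤self^self (d v)) ⟩
    ∏ (λ v → d v ^ d v)      ≡⟨ Π₂≡ G ⟨
    Π₂ G                     ∎
    where open ≤-Reasoning

  -- Equality Π₂(G) = 4^(n-2) forces maximum degree 2 and a vertex of degree 1.
  Π₂-extremal⇒path : Π₂ G ≡ 4 ^ m → G ≅ pathAdj
  Π₂-extremal⇒path Π₂≡4^m = PathFrom.iso G conn degree≤2 (proj₁ leaf) (s≤s⁻¹ (proj₂ leaf))
    where
    4^excess≤ : ∏ (λ v → 4 ^ excess v) ≤ 4 ^ m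
    4^excess≤ = subst (∏ (λ v → 4 ^ excess v) ≤_) (trans (sym (Π₂≡ G)) Π₂≡4^m) (∏-mono (λ v → 4^pred≤self^self (d v)))
    ∑excess≤m : ∑ excess ≤ m
    ∑excess≤m = 4^-cancel-≤ (subst (_≤ 4 ^ m) (∏-pow 4 excess) 4^excess≤)
    degree≤2 : ∀ v → d v ≤ 2
    degree≤2 v with d v ≤? 2
    ... | yes d≤2 = d≤2
    ... | no  d≰2 = contradiction (∏-mono-< (λ u → m^n>0 4 (excess u)) (λ u → 4^pred≤self^self (d u)) v
                                     (4^pred<self^self (d v) (≰⇒> d≰2)))
                                  (≤⇒≯ (begin
                                     ∏ (λ u → d u ^ d u)      ≡⟨ trans (sym (Π₂≡ G)) Π₂≡4^m ⟩
                                     4 ^ m                    ≤⟨ ^-monoʳ-≤ 4 m≤∑excess ⟩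
                                     4 ^ ∑ excess             ≡⟨ ∏-pow 4 excess ⟨
                                     ∏ (λ u → 4 ^ excess u)   ∎))
      where open ≤-Reasoning
    leaf : ∃ λ a → d a < 2
    leaf = ∑<⇒∃< d (λ _ → 2) (begin-strict
      ∑ d                  ≡⟨ degree-sum ⟩
      2 + m + ∑ excess     ≤⟨ +-monoʳ-≤ (2 + m) ∑excess≤m ⟩
      2 + m + m            <⟨ m<m+n (2 + m + m) (s≤s z≤n) ⟩
      2 + m + m + 2        ≡⟨ solve 1 (λ m → con 2 :+ m :+ m :+ con 2 := (con 2 :+ m) :* con 2) refl m ⟩
      (2 + m) * 2          ≡⟨ ∑-const {2 + m} 2 ⟨
      ∑ {2 + m} (λ _ → 2)  ∎)
      where open ≤-Reasoning

  -- In P_n all degrees are ≤ 2 and both ends have degree 1, so ∑ excess ≤ m.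
  path⇒∑excess≤m : G ≅ pathAdj → ∑ excess ≤ m
  path⇒∑excess≤m iso = +-cancelˡ-≤ (4 + m) (∑ excess) m (begin
    4 + m + ∑ excess    ≡⟨ cong (2 +_) (trans (sym degree-sum) (≅-∑-degree {G = G} {H = pathAdj} iso)) ⟩
    2 + ∑ path-degree   ≤⟨ ends ⟩
    (2 + m) * 2         ≡⟨ solve 1 (λ m → (con 2 :+ m) :* con 2 := con 4 :+ m :+ m) refl m ⟩
    4 + m + m           ∎)
    where
    open ≤-Reasoning
    path-degree : Fin (2 + m) → ℕ
    path-degree = degreeOf pathAdj
    ends : 2 + ∑ path-degree ≤ (2 + m) * 2
    ends = subst (2 + ∑ path-degree ≤_) (∑-const {2 + m} 2)
             (∑-gain₂ path-degree≤2 {zero} {fromℕ (suc m)} (λ ())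
                      (s≤s (path-degree-first {suc m})) (s≤s (path-degree-last {suc m})))

  -- Hence ∑ excess = m and every factor d^d equals 4^excess.
  path⇒Π₂-extremal : G ≅ pathAdj → Π₂ G ≡ 4 ^ m
  path⇒Π₂-extremal iso = begin
    Π₂ G                    ≡⟨ Π₂≡ G ⟩
    ∏ (λ v → d v ^ d v)     ≡⟨ ∏-cong (λ v → 4^pred≡self^self (d v) (degree≤2 v)) ⟩
    ∏ (λ v → 4 ^ excess v)  ≡⟨ ∏-pow 4 excess ⟩
    4 ^ ∑ excess            ≡⟨ cong (4 ^_) (≤-antisym (path⇒∑excess≤m iso) m≤∑excess) ⟩
    4 ^ m                   ∎
    where
    open ≡-Reasoning
    degree≤2 : ∀ v → d v ≤ 2
    degree≤2 v = subst (_≤ 2) (sym (≅-degree {G = G} {H = pathAdj} iso v)) (path-degree≤2 (Inverse.to (proj₁ iso) v))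

theorem3p3 : (n k : ℕ) → 2 ≤ n → 1 ≤ k → k ≤ n ∸ 1 →
    (G : SimpleGraph n) → Connected G → κ≤ G k →
    ((n ∸ 1) ^ 2 ≤ Π₁ G) × ((Π₁ G ≡ (n ∸ 1) ^ 2) ⇔ (G ≅ starAdj)) ×
    (4 ^ (n ∸ 2) ≤ Π₂ G) × ((Π₂ G ≡ 4 ^ (n ∸ 2)) ⇔ (G ≅ pathAdj))
theorem3p3 1 _ (s≤s ()) _ _ _ _ _
theorem3p3 (suc (suc m)) _ _ _ _ G conn _ =
    Π₁-lower , mk⇔ Π₁-extremal⇒star star⇒Π₁-extremal
  , Π₂-lower , mk⇔ Π₂-extremal⇒path path⇒Π₂-extremal
  where open ConnectedGraph G conn
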